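{- Let $n \geq 1$ and let $y = \{x_1, \ldots, x_n\}$ be a hereditarily finite set with $n$ pairwise distinct elements, indexed so that $\mathsf{ark}(x_i) \leq \mathsf{ark}(x_{i+1})$ for all $i \in \{1,\dots,n-1\}$. Then \[\mathsf{ark}(y) = \max\{\mathsf{ark}(x_j) + n - j:~ 1 \leq j \leq n\} + 1.\]
   Context: The adjunctive hierarchy of hereditarily finite sets is defined by $A_0 := \{\emptyset\}$ and $A_{n+1} := \{\emptyset\} \cup \{ x \cup \{y\} : x, y \in A_n\}$; then $A_n \subseteq A_{n+1}$ and $\bigcup_n A_n$ is the class of all hereditarily finite sets. The adjunctive rank of a hereditarily finite set $x$ is $\mathsf{ark}(x) := \min\{n : x \in A_n\}$. -}

module Defs where

open import Data.Nat using (ℕ; zero; suc; _+_; _^_; _<_; _⊔_)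
open import Data.Nat.DivMod using (_/_; _%_)
open import Data.Fin using (Fin; zero; suc)
open import Data.Product using (_×_; ∃; ∃-syntax)
open import Data.Sum using (_⊎_)
open import Relation.Binary.PropositionalEquality using (_≡_)
open import Relation.Nullary using (¬_; yes; no)
open import Data.Nat.Properties using (_≟_)

-- Hereditarily finite sets are represented by their Ackermann codes:
-- the natural number y codes the set { x : bit x of y is 1 }.
-- This is a bijection between ℕ and the class of all HF sets, under which
-- set equality is equality of codes.
HF : Set
HF = ℕ

shiftR : ℕ → ℕ → ℕ
shiftR zero    y = y
shiftR (suc x) y = shiftR x (y / 2)

_∈ₕ_ : HF → HF → Set
x ∈ₕ y = shiftR x y % 2 ≡ 1

∅ : HF
∅ = 0

adj : HF → HF → HF
adj x y with shiftR y x % 2 ≟ 1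
... | yes _ = x
... | no  _ = x + 2 ^ y

A : ℕ → HF → Set
A zero    z = z ≡ ∅
A (suc n) z = z ≡ ∅ ⊎ (∃[ x ] ∃[ y ] (A n x × A n y × z ≡ adj x y))

Ark : HF → ℕ → Set
Ark x k = A k x × (∀ m → m < k → ¬ A m x)

maxF : (n : ℕ) → (Fin n → ℕ) → ℕ
maxF zero    f = 0
maxF (suc n) f = f zero ⊔ maxF n (λ i → f (suc i))

-- Upper bound: adjoining x₁, …, xₙ to ∅ in this order yields y (codes are determined
-- by their members), and xⱼ ∈ A_(ark xⱼ) can be adjoined at level ark(xⱼ) + 1, each of
-- the n − j later adjunctions raising the level by one.
-- Lower bound: if y ∈ Aₘ has c + 1 distinct elements of ark ≥ r, then r + c < m.
-- Indeed y = x ∪ {z} with x, z ∈ Aₘ₋₁; if z is one of them then r ≤ ark z < m and the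
-- other c lie in x, otherwise all of them lie in x. Apply this to xⱼ, …, xₙ, whose
-- arks are at least ark(xⱼ).

module Submission where

open import Defs
open import Data.Nat using (ℕ; zero; suc; _+_; _*_; _∸_; _^_; _≤_; _<_; z≤n; s≤s)
open import Data.Nat.Properties
open import Data.Nat.DivMod
open import Data.Nat.Divisibility using (m%n≡0⇒n∣m; m∣m*n)
open import Data.Nat.Induction using (<-rec)
open import Data.Fin using (Fin; zero; suc; toℕ; fromℕ; fromℕ<; inject₁; punchIn)
open import Data.Fin.Properties using (toℕ-fromℕ; toℕ-fromℕ<; toℕ-inject₁; toℕ-injective; toℕ<n; any?; punchIn-injective; punchInᵢ≢i)
open import Data.Fin.Relation.Unary.Top using (view; ‵fromℕ; ‵inject₁)
open import Data.Product using (_,_; ∃-syntax; proj₁; map)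
open import Data.Sum using (_⊎_; inj₁; inj₂; [_,_])
open import Function using (_⇔_; _∘_; id; mk⇔; Equivalence)
open import Function.Definitions using (Injective)
import Function.Properties.Equivalence as ⇔
open import Relation.Nullary using (¬_; yes; no; contradiction)
open import Relation.Binary.PropositionalEquality using (_≡_; _≢_; refl; sym; trans; cong; cong₂; subst; module ≡-Reasoning)

%2≢1⇒%2≡0 : ∀ x → x % 2 ≢ 1 → x % 2 ≡ 0
%2≢1⇒%2≡0 x x%2≢1 with x % 2 | m%n<n x 2
... | 0 | _ = refl
... | 1 | _ = contradiction refl x%2≢1
... | suc (suc _) | s≤s (s≤s ())

⇔⇒%2≡ : ∀ x y → (x % 2 ≡ 1 ⇔ y % 2 ≡ 1) → x % 2 ≡ y % 2
⇔⇒%2≡ x y x⇔y with x % 2 ≟ 1 | y % 2 ≟ 1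
... | yes x₁ | yes y₁ = trans x₁ (sym y₁)
... | yes x₁ | no  y₀ = contradiction (Equivalence.to x⇔y x₁) y₀
... | no  x₀ | yes y₁ = contradiction (Equivalence.from x⇔y y₁) x₀
... | no  x₀ | no  y₀ = trans (%2≢1⇒%2≡0 x x₀) (sym (%2≢1⇒%2≡0 y y₀))

[m+2k]/2≡m/2+k : ∀ m k → (m + 2 * k) / 2 ≡ m / 2 + k
[m+2k]/2≡m/2+k m k = begin
  (m + 2 * k) / 2   ≡⟨ +-distrib-/-∣ʳ m (m∣m*n k) ⟩
  m / 2 + 2 * k / 2 ≡⟨ cong (m / 2 +_) (trans (/-congˡ (*-comm 2 k)) (m*n/n≡m k 2)) ⟩
  m / 2 + k         ∎
  where open ≡-Reasoning

∅-empty : ∀ z → ¬ z ∈ₕ ∅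
∅-empty zero    ()
∅-empty (suc z) = ∅-empty z

∈-+2^ : ∀ y x → ¬ y ∈ₕ x → y ∈ₕ (x + 2 ^ y)
∈-+2^ zero    x 0∉x = %-remove-+ˡ 1 (m%n≡0⇒n∣m x 2 (%2≢1⇒%2≡0 x 0∉x))
∈-+2^ (suc y) x y∉x =
  subst (y ∈ₕ_) (sym ([m+2k]/2≡m/2+k x (2 ^ y))) (∈-+2^ y (x / 2) y∉x)

bit-+2^ : ∀ y x → ¬ y ∈ₕ x → ∀ z → z ≢ y → shiftR z (x + 2 ^ y) % 2 ≡ shiftR z x % 2
bit-+2^ zero    x 0∉x zero    z≢y = contradiction refl z≢y
bit-+2^ zero    x 0∉x (suc z) z≢y = cong (λ t → shiftR z t % 2)
  (trans (+-distrib-/-∣ˡ 1 (m%n≡0⇒n∣m x 2 (%2≢1⇒%2≡0 x 0∉x))) (+-identityʳ (x / 2)))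
bit-+2^ (suc y) x y∉x zero    z≢y = %-remove-+ʳ x (m∣m*n (2 ^ y))
bit-+2^ (suc y) x y∉x (suc z) z≢y = trans
  (cong (λ t → shiftR z t % 2) ([m+2k]/2≡m/2+k x (2 ^ y)))
  (bit-+2^ y (x / 2) y∉x z (z≢y ∘ cong suc))

∈-adj : ∀ x y z → z ∈ₕ adj x y ⇔ (z ∈ₕ x ⊎ z ≡ y)
∈-adj x y z with shiftR y x % 2 ≟ 1
... | yes y∈x = mk⇔ inj₁ [ id , (λ z≡y → subst (_∈ₕ x) (sym z≡y) y∈x) ]
... | no  y∉x = mk⇔ to from
  where
  to : z ∈ₕ (x + 2 ^ y) → z ∈ₕ x ⊎ z ≡ y
  to z∈ with z ≟ y
  ... | yes z≡y = inj₂ z≡y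
  ... | no  z≢y = inj₁ (trans (sym (bit-+2^ y x y∉x z z≢y)) z∈)
  from : z ∈ₕ x ⊎ z ≡ y → z ∈ₕ (x + 2 ^ y)
  from (inj₂ refl) = ∈-+2^ y x y∉x
  from (inj₁ z∈x) with z ≟ y
  ... | yes refl = contradiction z∈x y∉x
  ... | no  z≢y  = trans (bit-+2^ y x y∉x z z≢y) z∈x

∈-adj⁻ : ∀ {x y z} → z ∈ₕ adj x y → z ≢ y → z ∈ₕ x
∈-adj⁻ {x} {y} {z} z∈ z≢y = [ id , (λ z≡y → contradiction z≡y z≢y) ] (Equivalence.to (∈-adj x y z) z∈)

no-members⇒≡∅ : ∀ a → (∀ z → ¬ z ∈ₕ a) → a ≡ ∅
no-members⇒≡∅ = <-rec _ step
  where
  step : ∀ a → (∀ {b} → b < a → (∀ z → ¬ z ∈ₕ b) → b ≡ ∅) → (∀ z → ¬ z ∈ₕ a) → a ≡ ∅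
  step zero      _   _   = refl
  step a@(suc _) rec ∉a = begin
    a                 ≡⟨ m≡m%n+[m/n]*n a 2 ⟩
    a % 2 + a / 2 * 2 ≡⟨ cong₂ (λ b q → b + q * 2) (%2≢1⇒%2≡0 a (∉a 0)) (rec (m/n<m a 2 (s≤s (s≤s z≤n))) (∉a ∘ suc)) ⟩
    0                 ∎
    where open ≡-Reasoning

∈ₕ-ext : ∀ a b → (∀ z → z ∈ₕ a ⇔ z ∈ₕ b) → a ≡ b
∈ₕ-ext = <-rec _ step
  where
  step : ∀ a → (∀ {a′} → a′ < a → ∀ b → (∀ z → z ∈ₕ a′ ⇔ z ∈ₕ b) → a′ ≡ b)
       → ∀ b → (∀ z → z ∈ₕ a ⇔ z ∈ₕ b) → a ≡ b
  step zero      _   b a⇔b = sym (no-members⇒≡∅ b (λ z z∈b → ∅-empty z (Equivalence.from (a⇔b z) z∈b)))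
  step a@(suc _) rec b a⇔b = begin
    a                 ≡⟨ m≡m%n+[m/n]*n a 2 ⟩
    a % 2 + a / 2 * 2 ≡⟨ cong₂ (λ b q → b + q * 2) (⇔⇒%2≡ a b (a⇔b 0)) (rec (m/n<m a 2 (s≤s (s≤s z≤n))) (b / 2) (a⇔b ∘ suc)) ⟩
    b % 2 + b / 2 * 2 ≡⟨ m≡m%n+[m/n]*n b 2 ⟨
    b                 ∎
    where open ≡-Reasoning

∅∈A : ∀ m → A m ∅
∅∈A zero    = refl
∅∈A (suc m) = inj₁ refl

A-mono : ∀ {k m x} → k ≤ m → A k x → A m x
A-mono {zero} {m} _ refl = ∅∈A m
A-mono (s≤s k≤m) (inj₁ x≡∅) = inj₁ x≡∅
A-mono (s≤s k≤m) (inj₂ (a , b , Aa , Ab , x≡)) = inj₂ (a , b , A-mono k≤m Aa , A-mono k≤m Ab , x≡)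

build : (n : ℕ) → (Fin n → HF) → HF
build zero    xs = ∅
build (suc n) xs = adj (build n (xs ∘ inject₁)) (xs (fromℕ n))

∈-build : ∀ n (xs : Fin n → HF) z → z ∈ₕ build n xs ⇔ (∃[ i ] xs i ≡ z)
∈-build zero    xs z = mk⇔ (λ z∈∅ → contradiction z∈∅ (∅-empty z)) (λ ())
∈-build (suc n) xs z = mk⇔ to from
  where
  init : Fin n → HF
  init = xs ∘ inject₁
  last : HF
  last = xs (fromℕ n)
  to : z ∈ₕ build (suc n) xs → ∃[ i ] xs i ≡ z
  to z∈ with Equivalence.to (∈-adj (build n init) last z) z∈
  ... | inj₁ z∈init = map inject₁ id (Equivalence.to (∈-build n init z) z∈init)
  ... | inj₂ z≡last = fromℕ n , sym z≡last
  from : ∃[ i ] xs i ≡ z → z ∈ₕ build (suc n) xs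
  from (i , refl) with view i
  ... | ‵fromℕ     = Equivalence.from (∈-adj (build n init) last last) (inj₂ refl)
  ... | ‵inject₁ j = Equivalence.from (∈-adj (build n init) last (init j))
                       (inj₁ (Equivalence.from (∈-build n init (init j)) (j , refl)))

A-build : ∀ n (xs : Fin n → HF) (r : Fin n → ℕ) → (∀ i → A (r i) (xs i))
        → ∀ m → (∀ i → r i + (n ∸ suc (toℕ i)) < m) → A m (build n xs)
A-build zero    xs r Axs m       _     = ∅∈A m
A-build (suc n) xs r Axs zero    bound = contradiction (bound zero) λ ()
A-build (suc n) xs r Axs (suc m) bound =
  inj₂ (_ , _ , A-build n (xs ∘ inject₁) (r ∘ inject₁) (Axs ∘ inject₁) m init-bound , A-mono last-bound (Axs (fromℕ n)) , refl)
  where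
  init-bound : ∀ i → r (inject₁ i) + (n ∸ suc (toℕ i)) < m
  init-bound i = ≤-pred (begin-strict
    suc (r (inject₁ i) + (n ∸ suc (toℕ i)))   ≡⟨ +-suc _ _ ⟨
    r (inject₁ i) + suc (n ∸ suc (toℕ i))     ≡⟨ cong (r (inject₁ i) +_) (+-∸-assoc 1 (toℕ<n i)) ⟨
    r (inject₁ i) + (n ∸ toℕ i)               ≡⟨ cong (λ t → r (inject₁ i) + (n ∸ t)) (toℕ-inject₁ i) ⟨
    r (inject₁ i) + (n ∸ toℕ (inject₁ i))     <⟨ bound (inject₁ i) ⟩
    suc m                                     ∎)
    where open ≤-Reasoning
  last-bound : r (fromℕ n) ≤ m
  last-bound = ≤-pred (begin-strict
    r (fromℕ n)                       ≡⟨ +-identityʳ _ ⟨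
    r (fromℕ n) + 0                   ≡⟨ cong (r (fromℕ n) +_) (n∸n≡0 n) ⟨
    r (fromℕ n) + (n ∸ n)             ≡⟨ cong (λ t → r (fromℕ n) + (n ∸ t)) (toℕ-fromℕ n) ⟨
    r (fromℕ n) + (n ∸ toℕ (fromℕ n)) <⟨ bound (fromℕ n) ⟩
    suc m                             ∎)
    where open ≤-Reasoning

ArkAtLeast : ℕ → HF → Set
ArkAtLeast r x = ∀ k → A k x → r ≤ k

Ark⇒ArkAtLeast : ∀ {x r} → Ark x r → ArkAtLeast r x
Ark⇒ArkAtLeast (_ , below-r) k Ak = ≮⇒≥ (λ k<r → below-r k k<r Ak)

A⇒ark+card< : ∀ {m y c r} → A m y → (zs : Fin (suc c) → HF) → Injective _≡_ _≡_ zs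
            → (∀ i → zs i ∈ₕ y) → (∀ i → ArkAtLeast r (zs i)) → r + c < m
A⇒ark+card< {zero}  refl        zs _ zs⊆y _ = contradiction (zs⊆y zero) (∅-empty (zs zero))
A⇒ark+card< {suc m} (inj₁ refl) zs _ zs⊆y _ = contradiction (zs⊆y zero) (∅-empty (zs zero))
A⇒ark+card< {suc m} {c = c} (inj₂ (x , z , Ax , Az , refl)) zs inj zs⊆y zs≥r with any? (λ k → zs k ≟ z)
... | no z∉zs = m<n⇒m<1+n (A⇒ark+card< Ax zs inj (λ i → ∈-adj⁻ (zs⊆y i) (λ e → z∉zs (i , e))) zs≥r)
... | yes (k , refl) with c
...   | zero   = s≤s (≤-trans (≤-reflexive (+-identityʳ _)) (zs≥r k m Az))
...   | suc c′ = s≤s (≤-trans (≤-reflexive (+-suc _ c′))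
                   (A⇒ark+card< Ax (zs ∘ punchIn k) (λ {a} {b} e → punchIn-injective k a b (inj e))
                     (λ j → ∈-adj⁻ (zs⊆y (punchIn k j)) (punchInᵢ≢i k j ∘ inj)) (zs≥r ∘ punchIn k)))

Sorted : ∀ {n} → (Fin n → ℕ) → Set
Sorted r = ∀ i j → toℕ j ≡ suc (toℕ i) → r i ≤ r j

Sorted-tail : ∀ {n} (r : Fin (suc n) → ℕ) → Sorted r → Sorted (r ∘ suc)
Sorted-tail r sorted i j j≡1+i = sorted (suc i) (suc j) (cong suc j≡1+i)

Sorted-monotone : ∀ {n} (r : Fin n → ℕ) → Sorted r → ∀ {i j} → toℕ i ≤ toℕ j → r i ≤ r j
Sorted-monotone r sorted {zero} {zero} _ = ≤-refl
Sorted-monotone {suc (suc n)} r sorted {zero} {suc j} _ =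
  ≤-trans (sorted zero (suc zero) refl) (Sorted-monotone (r ∘ suc) (Sorted-tail r sorted) z≤n)
Sorted-monotone r sorted {suc i} {suc j} (s≤s i≤j) = Sorted-monotone (r ∘ suc) (Sorted-tail r sorted) i≤j

maxF-ub : ∀ n (f : Fin n → ℕ) i → f i ≤ maxF n f
maxF-ub (suc n) f zero    = m≤m⊔n _ _
maxF-ub (suc n) f (suc i) = ≤-trans (maxF-ub n (f ∘ suc) i) (m≤n⊔m _ _)

maxF-<-lub : ∀ n (f : Fin (suc n) → ℕ) b → (∀ i → f i < b) → maxF (suc n) f < b
maxF-<-lub zero    f b f<b = ⊔-lub (f<b zero) (≤-trans (s≤s z≤n) (f<b zero))
maxF-<-lub (suc n) f b f<b = ⊔-lub (f<b zero) (maxF-<-lub n (f ∘ suc) b (f<b ∘ suc))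

i+j<n : ∀ {n} (i : Fin n) (j : Fin (suc (n ∸ suc (toℕ i)))) → toℕ i + toℕ j < n
i+j<n {n} i j = begin-strict
  toℕ i + toℕ j                    <⟨ +-monoʳ-< (toℕ i) (toℕ<n j) ⟩
  toℕ i + suc (n ∸ suc (toℕ i))    ≡⟨ +-suc (toℕ i) _ ⟩
  suc (toℕ i) + (n ∸ suc (toℕ i))  ≡⟨ m+[n∸m]≡n (toℕ<n i) ⟩
  n                                ∎
  where open ≤-Reasoning

offset : ∀ {n} (i : Fin n) → Fin (suc (n ∸ suc (toℕ i))) → Fin n
offset i j = fromℕ< (i+j<n i j)

offset-injective : ∀ {n} (i : Fin n) → Injective _≡_ _≡_ (offset i)
offset-injective i {j} {k} e = toℕ-injective (+-cancelˡ-≡ (toℕ i) (toℕ j) (toℕ k)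
  (trans (sym (toℕ-fromℕ< (i+j<n i j))) (trans (cong toℕ e) (toℕ-fromℕ< (i+j<n i k)))))

i≤offset : ∀ {n} (i : Fin n) j → toℕ i ≤ toℕ (offset i j)
i≤offset i j = ≤-trans (m≤m+n (toℕ i) (toℕ j)) (≤-reflexive (sym (toℕ-fromℕ< (i+j<n i j))))

A⇒ark+rest< : ∀ {m y n} → A m y → (xs : Fin n → HF) → Injective _≡_ _≡_ xs → (∀ i → xs i ∈ₕ y)
            → (r : Fin n → ℕ) → (∀ i → Ark (xs i) (r i)) → Sorted r
            → ∀ i → r i + (n ∸ suc (toℕ i)) < m
A⇒ark+rest< Am xs inj xs⊆y r ark sorted i =
  A⇒ark+card< Am (xs ∘ offset i) (offset-injective i ∘ inj) (xs⊆y ∘ offset i)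
    (λ j k Ak → ≤-trans (Sorted-monotone r sorted (i≤offset i j)) (Ark⇒ArkAtLeast (ark (offset i j)) k Ak))

lemma1 : (n : ℕ) → 1 ≤ n → (y : HF) → (xs : Fin n → HF) → Injective _≡_ _≡_ xs
    → (∀ z → (z ∈ₕ y) ⇔ (∃[ i ] xs i ≡ z))
    → (r : Fin n → ℕ) → (∀ i → Ark (xs i) (r i))
    → (∀ i j → toℕ j ≡ suc (toℕ i) → r i ≤ r j)
    → Ark y (suc (maxF n (λ i → r i + (n ∸ suc (toℕ i)))))
lemma1 (suc n) _ y xs inj y≐xs r ark sorted = A-level , below-level
  where
  weight : Fin (suc n) → ℕ
  weight i = r i + (suc n ∸ suc (toℕ i))
  y≡build : y ≡ build (suc n) xs
  y≡build = ∈ₕ-ext y (build (suc n) xs) λ z → ⇔.trans (y≐xs z) (⇔.sym (∈-build (suc n) xs z))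
  A-level : A (suc (maxF (suc n) weight)) y
  A-level = subst (A _) (sym y≡build)
    (A-build (suc n) xs r (proj₁ ∘ ark) _ (λ i → s≤s (maxF-ub (suc n) weight i)))
  below-level : ∀ m → m < suc (maxF (suc n) weight) → ¬ A m y
  below-level m m≤max Am = ≤⇒≯ (≤-pred m≤max) (maxF-<-lub n weight m
    (A⇒ark+rest< Am xs inj (λ i → Equivalence.from (y≐xs (xs i)) (i , refl)) r ark sorted))
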